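{- Let $\langle S,A\rangle$ be an exact cover instance and let $\langle P,E,\tau\rangle$, $P=\langle\Omega,F,\pi\rangle$, be the persuasion instance constructed from it as described in the context. If $R\subseteq F$ satisfies $P(E\mid R)\ge\tau$, then $H_R=\{A_i : \exists r\in R\ \exists \ell\in\{1,\dots,n\}.\ s_\ell\in A_i \text{ and } Y_{i,\ell}\notin r\}$ is an exact cover of $S$, i.e. any two distinct members of $H_R$ are disjoint and $\bigcup H_R=S$.
   Context: An exact cover instance is a pair $\langle S,A\rangle$ with $S=\{s_1,\dots,s_n\}$ finite and $A=\{A_1,\dots,A_k\}$ a set of non-empty, pairwise different subsets of $S$ with $A_1\cup\dots\cup A_k=S$. Let $m=\sum_{i=1}^k|A_i|$. The constructed instance is: $\Omega=\{W_0\}\cup\{X_0\}\cup Y\cup Z$ where $Y=\{Y_{i,\ell}: 1\le i\le k,\ 1\le\ell\le n,\ s_\ell\in A_i\}$ ($m$ worlds) and $Z=\{Z_\ell:1\le\ell\le n\}$ ($n$ worlds); $F=\{F_1,\dots,F_k\}$ with $F_i=\Omega\setminus\{Y_{i,\ell}: s_\ell\in A_i\}\setminus\{Z_\ell: s_\ell\in A_i\}$; $\pi(W_0)=\pi(X_0)=x$, $\pi(Y_{i,\ell})=y$ for all $Y$-worlds, $\pi(Z_\ell)=z$ for all $Z$-worlds, where $x=1/3$, $y=\frac{1-2x}{m(1+2n)}$, $z=2my$; goal $E=\{W_0\}\cup Y$; threshold $\tau=\frac{x+(m-n)y}{2x+(m-n)y}$. For $R\subseteq F$ (an observation), $P(E\mid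 R)=\pi^*(E\cap\bigcap R)/\pi^*(\bigcap R)$, where $\pi^*(T)=\sum_{\omega\in T}\pi(\omega)$ and $\bigcap\emptyset=\Omega$. -}

module Defs where

open import Data.Bool using (Bool; true; false; _∧_; not; if_then_else_)
open import Data.Nat as ℕ using (ℕ)
open import Data.Integer using (+_)
open import Data.Fin using (Fin)
open import Data.Fin.Subset using (Subset; _∈_; ∣_∣; Nonempty)
open import Data.Fin.Properties using () renaming (_≟_ to _≟F_)
open import Data.Vec using (lookup)
open import Data.List as List using (List; []; _∷_; _++_; allFin; concatMap; filterᵇ; map; foldr)
open import Data.Product using (Σ; ∃; _×_)
open import Data.Rational using (ℚ; 0ℚ; 1ℚ; _+_; _*_; _-_; _÷_; _/_; ≢-nonZero)
open import Data.Rational.Properties using (_≟_)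
open import Relation.Nullary using (yes; no; ¬_; does)
open import Relation.Binary.PropositionalEquality using (_≡_; _≢_)

-- Total division on ℚ (returns 0 when the denominator is 0).  In the
-- constructed instance every denominator used is nonzero (for n ≥ 1).
_÷ₜ_ : ℚ → ℚ → ℚ
p ÷ₜ q with q ≟ 0ℚ
... | yes _ = 0ℚ
... | no q≢0 = _÷_ p q {{≢-nonZero q≢0}}

ℕtoℚ : ℕ → ℚ
ℕtoℚ m = (+ m) / 1

record ExactCoverInstance (n k : ℕ) : Set where
  field
    A        : Fin k → Subset n
    nonempty : ∀ i → Nonempty (A i)
    distinct : ∀ i j → A i ≡ A j → i ≡ j
    covers   : ∀ (ℓ : Fin n) → ∃ λ i → ℓ ∈ A i

module Construction {n k : ℕ} (I : ExactCoverInstance n k) where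
  open ExactCoverInstance I

  -- world codes; Y i ℓ is a genuine world only when s_ℓ ∈ A_i
  data World : Set where
    W0 X0 : World
    Y     : Fin k → Fin n → World
    Z     : Fin n → World

  Ω : List World
  Ω = W0 ∷ X0 ∷ (concatMap (λ i → map (Y i) (filterᵇ (λ ℓ → lookup (A i) ℓ) (allFin n))) (allFin k)
                 ++ map Z (allFin n))

  WSet : Set
  WSet = World → Bool

  inF : Fin k → WSet
  inF i W0      = true
  inF i X0      = true
  inF i (Y j ℓ) = not (does (i ≟F j) ∧ lookup (A i) ℓ)
  inF i (Z ℓ)   = not (lookup (A i) ℓ)

  -- ⋂ R for an observation R ⊆ F, given as a set of indices (⋂ ∅ = Ω)
  ⋂ : Subset k → WSet
  ⋂ R w = foldr (λ i b → (if lookup R i then inF i w else true) ∧ b) true (allFin k)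

  inE : WSet
  inE W0      = true
  inE X0      = false
  inE (Y _ _) = true
  inE (Z _)   = false

  _∩_ : WSet → WSet → WSet
  (T ∩ U) w = T w ∧ U w

  m : ℕ
  m = foldr (λ i s → ∣ A i ∣ ℕ.+ s) 0 (allFin k)

  x y z : ℚ
  x = (+ 1) / 3
  y = (1ℚ - (ℕtoℚ 2 * x)) ÷ₜ (ℕtoℚ m * (1ℚ + ℕtoℚ 2 * ℕtoℚ n))
  z = ℕtoℚ 2 * ℕtoℚ m * y

  π : World → ℚ
  π W0      = x
  π X0      = x
  π (Y _ _) = y
  π (Z _)   = z

  π* : WSet → ℚ
  π* T = foldr _+_ 0ℚ (map π (filterᵇ T Ω))

  τ : ℚ
  τ = (x + (ℕtoℚ m - ℕtoℚ n) * y) ÷ₜ (ℕtoℚ 2 * x + (ℕtoℚ m - ℕtoℚ n) * y)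

  condP : Subset k → ℚ
  condP R = π* (inE ∩ ⋂ R) ÷ₜ π* (⋂ R)

  InH : Subset k → Fin k → Set
  InH R i = ∃ λ r → r ∈ R × ∃ λ ℓ → ℓ ∈ A i × inF r (Y i ℓ) ≡ false

  IsExactCover : Subset k → Set
  IsExactCover R =
    (∀ i j → InH R i → InH R j → A i ≢ A j → ∀ (ℓ : Fin n) → ¬ (ℓ ∈ A i × ℓ ∈ A j))
    × (∀ (ℓ : Fin n) → ∃ λ i → InH R i × ℓ ∈ A i)

module Submission where

open import Defs
open import Data.Nat using (ℕ)
open import Data.Fin.Subset using (Subset)
open import Data.Rational using (_≤_)

open import Data.Bool using (Bool; true; false; _∧_; not; if_then_else_)
open import Data.Bool.Properties using (∧-zeroʳ)
open import Data.Fin using (Fin; zero; suc)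
open import Data.Fin.Properties using () renaming (_≟_ to _≟F_)
open import Data.Fin.Subset using (∣_∣) renaming (_∈_ to _∈ₛ_)
import Data.Integer as ℤ
import Data.Integer.Properties as ℤ
open import Data.List as List using (List; []; _∷_; _++_; tabulate; filterᵇ; map; foldr; concatMap)
open import Data.List.Membership.Propositional using (_∈_)
open import Data.List.Membership.Propositional.Properties using (∈-allFin)
open import Data.List.Properties using (filter-++; filter-all)
open import Data.List.Relation.Unary.All using (universal)
open import Data.List.Relation.Unary.Any using (here; there)
open import Data.Nat as ℕ using (zero; suc; z≤n; s≤s; _∸_)
import Data.Nat.Properties as ℕ
import Data.Nat.Coprimality as Coprime
open import Data.Product using (∃; _,_; _×_)
open import Data.Rational as ℚ using (ℚ; mkℚ; 0ℚ; 1ℚ; _+_; _*_; _-_; -_; Positive; NonNegative)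
open import Data.Rational.Properties
open import Data.Rational.Solver using (module +-*-Solver)
open import Data.Vec as Vec using (lookup)
open import Data.Vec.Properties using ([]=⇒lookup; lookup⇒[]=)
open import Function using (_∘_; id)
open import Relation.Binary.PropositionalEquality
open import Relation.Nullary using (¬_; contradiction; yes; no)
open import Relation.Nullary.Decidable using (T?; dec-true)
open import Algebra.Properties.CommutativeMonoid.Sum ℕ.+-0-commutativeMonoid
  using (sum; sum-syntax; ∑-comm; ∑-distrib-+; sum-cong-≗; sum-replicate-zero)

-- Let T = ⋂R.  A world Y_{i,ℓ} lies in T iff i ∉ R, and Z_ℓ lies in T iff no chosen set
-- contains s_ℓ.  With #Y, #Z the numbers of Y- and Z-worlds in T and z = 2my,
--   P(E | R) = (x + #Y·y) / (2x + #Y·y + #Z·z),   τ = (x + (m − n)·y) / (2x + (m − n)·y),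
-- and cross-multiplying τ ≤ P(E | R) leaves (m − n) + 2m·#Z ≤ #Y ≤ m.  So #Z = 0, i.e. the
-- chosen sets cover S, and the m − #Y ≤ n discarded Y-worlds, counted point by point, give
-- Σ_ℓ |{i ∈ R : s_ℓ ∈ A_i}| ≤ n with every summand ≥ 1.  Hence every point lies in exactly
-- one chosen set.  Finally A_i ∈ H_R forces i ∈ R, since only F_i omits a world Y_{i,ℓ}.

⟦_⟧ : Bool → ℕ
⟦ true ⟧  = 1
⟦ false ⟧ = 0

⟦⟧≡0⇒≡false : ∀ {b} → ⟦ b ⟧ ≡ 0 → b ≡ false
⟦⟧≡0⇒≡false {false} _ = refl

⟦∧not⟧+⟦∧⟧≡⟦⟧ : ∀ a b → ⟦ a ∧ not b ⟧ ℕ.+ ⟦ a ∧ b ⟧ ≡ ⟦ a ⟧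
⟦∧not⟧+⟦∧⟧≡⟦⟧ false _     = refl
⟦∧not⟧+⟦∧⟧≡⟦⟧ true  true  = refl
⟦∧not⟧+⟦∧⟧≡⟦⟧ true  false = refl

m<n⇒c*n≤m⇒c≡0 : ∀ {c m n} → m ℕ.< n → c ℕ.* n ℕ.≤ m → c ≡ 0
m<n⇒c*n≤m⇒c≡0 {zero}          _   _     = refl
m<n⇒c*n≤m⇒c≡0 {suc _} {n = n} m<n c*n≤m = contradiction (ℕ.≤-trans (ℕ.m≤m+n n _) c*n≤m) (ℕ.<⇒≱ m<n)

term≤sum : ∀ {j} (f : Fin j → ℕ) i → f i ℕ.≤ sum f
term≤sum f zero    = ℕ.m≤m+n _ _
term≤sum f (suc i) = ℕ.≤-trans (term≤sum (f ∘ suc) i) (ℕ.m≤n+m _ _)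

two-terms≤sum : ∀ {j} (f : Fin j → ℕ) {i i′} → i ≢ i′ → f i ℕ.+ f i′ ℕ.≤ sum f
two-terms≤sum f {zero}  {zero}   i≢i′ = contradiction refl i≢i′
two-terms≤sum f {zero}  {suc i′} _    = ℕ.+-monoʳ-≤ (f zero) (term≤sum (f ∘ suc) i′)
two-terms≤sum f {suc i} {zero}   _    = ℕ.≤-trans (ℕ.≤-reflexive (ℕ.+-comm (f (suc i)) (f zero)))
                                                  (ℕ.+-monoʳ-≤ (f zero) (term≤sum (f ∘ suc) i))
two-terms≤sum f {suc i} {suc i′} i≢i′ = ℕ.≤-trans (two-terms≤sum (f ∘ suc) (i≢i′ ∘ cong suc)) (ℕ.m≤n+m _ _)

sum≡0⇒term≡0 : ∀ {j} (f : Fin j → ℕ) → sum f ≡ 0 → ∀ i → f i ≡ 0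
sum≡0⇒term≡0 f ∑f≡0 i = ℕ.n≤0⇒n≡0 (ℕ.≤-trans (term≤sum f i) (ℕ.≤-reflexive ∑f≡0))

size≤sum : ∀ {j} (f : Fin j → ℕ) → (∀ i → 1 ℕ.≤ f i) → j ℕ.≤ sum f
size≤sum {zero}  f _   = z≤n
size≤sum {suc _} f 1≤f = ℕ.+-mono-≤ (1≤f zero) (size≤sum (f ∘ suc) (1≤f ∘ suc))

sum≤size⇒term≤1 : ∀ {j} (f : Fin j → ℕ) → (∀ i → 1 ℕ.≤ f i) → sum f ℕ.≤ j → ∀ i → f i ℕ.≤ 1
sum≤size⇒term≤1 f 1≤f ∑f≤j zero =
  ℕ.+-cancelʳ-≤ _ _ _ (ℕ.≤-trans (ℕ.+-monoʳ-≤ (f zero) (size≤sum (f ∘ suc) (1≤f ∘ suc))) ∑f≤j)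
sum≤size⇒term≤1 f 1≤f ∑f≤j (suc i) =
  sum≤size⇒term≤1 (f ∘ suc) (1≤f ∘ suc) (ℕ.+-cancelˡ-≤ 1 _ _ (ℕ.≤-trans (ℕ.+-monoˡ-≤ _ (1≤f zero)) ∑f≤j)) i

foldr-tabulate≡sum : ∀ {A : Set} {j} (g : A → ℕ) (f : Fin j → A) →
                     foldr (λ a s → g a ℕ.+ s) 0 (tabulate f) ≡ sum (g ∘ f)
foldr-tabulate≡sum {j = zero}  g f = refl
foldr-tabulate≡sum {j = suc _} g f = cong (g (f zero) ℕ.+_) (foldr-tabulate≡sum g (f ∘ suc))

∣p∣≡sum : ∀ {j} (p : Subset j) → ∣ p ∣ ≡ sum (λ ℓ → ⟦ lookup p ℓ ⟧)
∣p∣≡sum Vec.[]          = refl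
∣p∣≡sum (true Vec.∷ p)  = cong suc (∣p∣≡sum p)
∣p∣≡sum (false Vec.∷ p) = ∣p∣≡sum p

true-term⇒1≤sum : ∀ {j} (b : Fin j → Bool) i → b i ≡ true → 1 ℕ.≤ ∑[ i < j ] ⟦ b i ⟧
true-term⇒1≤sum b i bᵢ≡true = ℕ.≤-trans (ℕ.≤-reflexive (cong ⟦_⟧ (sym bᵢ≡true))) (term≤sum (⟦_⟧ ∘ b) i)

module _ {A : Set} (c : A → Bool) where

  foldr-∧-true : ∀ xs → (∀ a → c a ≡ true) → foldr (λ a b → c a ∧ b) true xs ≡ true
  foldr-∧-true []       _     = refl
  foldr-∧-true (a ∷ xs) c≡true rewrite c≡true a = foldr-∧-true xs c≡true

  foldr-∧-false : ∀ {a xs} → a ∈ xs → c a ≡ false → foldr (λ a b → c a ∧ b) true xs ≡ false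
  foldr-∧-false (here refl) ca≡false rewrite ca≡false = refl
  foldr-∧-false {xs = a′ ∷ _} (there a∈xs) ca≡false =
    trans (cong (c a′ ∧_) (foldr-∧-false a∈xs ca≡false)) (∧-zeroʳ (c a′))

  foldr-∧-false⁻ : ∀ xs → foldr (λ a b → c a ∧ b) true xs ≡ false → ∃ λ a → c a ≡ false
  foldr-∧-false⁻ (a ∷ xs) fold≡false with c a in ca
  ... | true  = foldr-∧-false⁻ xs fold≡false
  ... | false = a , ca

ℕtoℚ≡mkℚ : ∀ a → ℕtoℚ a ≡ mkℚ (ℤ.+ a) 0 (Coprime.sym (Coprime.1-coprimeTo a))
ℕtoℚ≡mkℚ a = normalize-coprime _

ℕtoℚ-+ : ∀ a b → ℕtoℚ (a ℕ.+ b) ≡ ℕtoℚ a + ℕtoℚ b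
ℕtoℚ-+ a b rewrite ℕtoℚ≡mkℚ a | ℕtoℚ≡mkℚ b =
  sym (cong (ℚ._/ 1) (cong₂ ℤ._+_ (ℤ.*-identityʳ (ℤ.+ a)) (ℤ.*-identityʳ (ℤ.+ b))))

ℕtoℚ-* : ∀ a b → ℕtoℚ (a ℕ.* b) ≡ ℕtoℚ a * ℕtoℚ b
ℕtoℚ-* a b rewrite ℕtoℚ≡mkℚ a | ℕtoℚ≡mkℚ b = cong (ℚ._/ 1) (ℤ.pos-* a b)

ℕtoℚ-+-* : ∀ a b w → ℕtoℚ (a ℕ.+ b) * w ≡ ℕtoℚ a * w + ℕtoℚ b * w
ℕtoℚ-+-* a b w = trans (cong (_* w) (ℕtoℚ-+ a b)) (*-distribʳ-+ w (ℕtoℚ a) (ℕtoℚ b))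

ℕtoℚ-∸ : ∀ {a b} → b ℕ.≤ a → ℕtoℚ a - ℕtoℚ b ≡ ℕtoℚ (a ∸ b)
ℕtoℚ-∸ {a} {b} b≤a = begin
  ℕtoℚ a - ℕtoℚ b                 ≡⟨ cong (λ t → ℕtoℚ t - ℕtoℚ b) (ℕ.m+[n∸m]≡n b≤a) ⟨
  ℕtoℚ (b ℕ.+ (a ∸ b)) - ℕtoℚ b   ≡⟨ cong (_- ℕtoℚ b) (ℕtoℚ-+ b (a ∸ b)) ⟩
  ℕtoℚ b + ℕtoℚ (a ∸ b) - ℕtoℚ b  ≡⟨ solve 2 (λ p q → p :+ q :- p := q) refl (ℕtoℚ b) (ℕtoℚ (a ∸ b)) ⟩
  ℕtoℚ (a ∸ b)                    ∎
  where
  open ≡-Reasoning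
  open +-*-Solver

ℕtoℚ-cancel-≤ : ∀ {a b} → ℕtoℚ a ≤ ℕtoℚ b → a ℕ.≤ b
ℕtoℚ-cancel-≤ {a} {b} ℕtoℚa≤ℕtoℚb rewrite ℕtoℚ≡mkℚ a | ℕtoℚ≡mkℚ b =
  ℤ.drop‿+≤+ (subst₂ ℤ._≤_ (ℤ.*-identityʳ (ℤ.+ a)) (ℤ.*-identityʳ (ℤ.+ b)) (drop-*≤* ℕtoℚa≤ℕtoℚb))

ℕtoℚ-nonNeg : ∀ a → NonNegative (ℕtoℚ a)
ℕtoℚ-nonNeg a = normalize-nonNeg a 1

ℕtoℚ-pos : ∀ a → .{{ℕ.NonZero a}} → Positive (ℕtoℚ a)
ℕtoℚ-pos a = normalize-pos a 1

+-cancelˡ-≤ : ∀ p {q r} → p + q ≤ p + r → q ≤ r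
+-cancelˡ-≤ p {q} {r} p+q≤p+r = subst₂ _≤_ (cancel q) (cancel r) (+-monoʳ-≤ (- p) p+q≤p+r)
  where
  open +-*-Solver
  cancel : ∀ s → - p + (p + s) ≡ s
  cancel = solve 2 (λ p s → :- p :+ (p :+ s) := s) refl p

p÷ₜq*q≡p : ∀ p q .{{_ : Positive q}} → (p ÷ₜ q) * q ≡ p
p÷ₜq*q≡p p q with q ≟ 0ℚ
... | yes q≡0 = contradiction (positive⁻¹ q) (<-irrefl (sym q≡0))
... | no q≢0 = begin
  p * ℚ.1/ q * q    ≡⟨ *-assoc p _ q ⟩
  p * (ℚ.1/ q * q)  ≡⟨ cong (p *_) (*-inverseˡ q) ⟩
  p * 1ℚ            ≡⟨ *-identityʳ p ⟩
  p                 ∎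
  where
  open ≡-Reasoning
  instance _ = ℚ.≢-nonZero q≢0

pos÷ₜpos⇒pos : ∀ p q .{{_ : Positive p}} .{{_ : Positive q}} → Positive (p ÷ₜ q)
pos÷ₜpos⇒pos p q with q ≟ 0ℚ
... | yes q≡0 = contradiction (positive⁻¹ q) (<-irrefl (sym q≡0))
... | no _    = pos*pos⇒pos p _ {{1/pos⇒pos q}}

÷ₜ-≤⇒*-≤ : ∀ p q r s .{{_ : Positive q}} .{{_ : Positive s}} → p ÷ₜ q ≤ r ÷ₜ s → p * s ≤ r * q
÷ₜ-≤⇒*-≤ p q r s p/q≤r/s = subst₂ _≤_ lhs rhs (*-monoʳ-≤-nonNeg (q * s) p/q≤r/s)
  where
  open ≡-Reasoning
  instance
    _ = pos*pos⇒pos q s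
    _ = pos⇒nonNeg (q * s)
  lhs : (p ÷ₜ q) * (q * s) ≡ p * s
  lhs = begin
    (p ÷ₜ q) * (q * s)  ≡⟨ *-assoc (p ÷ₜ q) q s ⟨
    (p ÷ₜ q) * q * s    ≡⟨ cong (_* s) (p÷ₜq*q≡p p q) ⟩
    p * s               ∎
  rhs : (r ÷ₜ s) * (q * s) ≡ r * q
  rhs = begin
    (r ÷ₜ s) * (q * s)  ≡⟨ cong ((r ÷ₜ s) *_) (*-comm q s) ⟩
    (r ÷ₜ s) * (s * q)  ≡⟨ *-assoc (r ÷ₜ s) s q ⟨
    (r ÷ₜ s) * s * q    ≡⟨ cong (_* q) (p÷ₜq*q≡p r s) ⟩
    r * q               ∎

p≤p+q : ∀ p q .{{_ : NonNegative q}} → p ≤ p + q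
p≤p+q p q = ≤-trans (≤-reflexive (sym (+-identityʳ p))) (+-monoʳ-≤ p (nonNegative⁻¹ q))

-- Cross-multiplied, both sides share the terms 2x² + axy + bxy + aby²; the rest reads
-- y (x (a + c) + acy) ≤ y (x b).
ratio-≤⇒a+c≤b : ∀ x y a b c .{{_ : Positive x}} .{{_ : Positive y}}
                .{{_ : NonNegative a}} .{{_ : NonNegative b}} .{{_ : NonNegative c}} →
                (x + a * y) ÷ₜ (x + x + a * y) ≤ (x + b * y) ÷ₜ (x + x + b * y + c * y) →
                a + c ≤ b
ratio-≤⇒a+c≤b x y a b c ratio≤ =
  *-cancelˡ-≤-pos x (≤-trans (p≤p+q (x * (a + c)) (a * c * y))
    (*-cancelˡ-≤-pos y (+-cancelˡ-≤ shared (subst₂ _≤_ lhs rhs cross))))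
  where
  instance
    _ = pos⇒nonNeg x
    _ = pos⇒nonNeg y
    _ = nonNeg*nonNeg⇒nonNeg a y
    _ = nonNeg*nonNeg⇒nonNeg b y
    _ = nonNeg*nonNeg⇒nonNeg c y
    _ = nonNeg*nonNeg⇒nonNeg a c
    _ = nonNeg*nonNeg⇒nonNeg (a * c) y
    _ = pos+pos⇒pos x x
    _ = pos+nonNeg⇒pos (x + x) (a * y)
    _ = pos+nonNeg⇒pos (x + x) (b * y)
    _ = pos+nonNeg⇒pos (x + x + b * y) (c * y)
  cross : (x + a * y) * (x + x + b * y + c * y) ≤ (x + b * y) * (x + x + a * y)
  cross = ÷ₜ-≤⇒*-≤ (x + a * y) _ (x + b * y) _ ratio≤
  open +-*-Solver
  shared : ℚ
  shared = (x + x) * x + a * x * y + b * x * y + a * b * y * y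
  lhs : (x + a * y) * (x + x + b * y + c * y) ≡ shared + y * (x * (a + c) + a * c * y)
  lhs = solve 5 (λ x y a b c → (x :+ a :* y) :* (x :+ x :+ b :* y :+ c :* y)
                  := (x :+ x) :* x :+ a :* x :* y :+ b :* x :* y :+ a :* b :* y :* y
                     :+ y :* (x :* (a :+ c) :+ a :* c :* y)) refl x y a b c
  rhs : (x + b * y) * (x + x + a * y) ≡ shared + y * (x * b)
  rhs = solve 5 (λ x y a b c → (x :+ b :* y) :* (x :+ x :+ a :* y)
                  := (x :+ x) :* x :+ a :* x :* y :+ b :* x :* y :+ a :* b :* y :* y
                     :+ y :* (x :* b)) refl x y a b c

module _ {B : Set} (wt : B → ℚ) where

  weight : List B → ℚ
  weight bs = foldr _+_ 0ℚ (map wt bs)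

  weight-filter-accept : ∀ (S : B → Bool) b bs → S b ≡ true →
                         weight (filterᵇ S (b ∷ bs)) ≡ wt b + weight (filterᵇ S bs)
  weight-filter-accept S b bs Sb≡true rewrite Sb≡true = refl

  weight-filter-++ : ∀ (S : B → Bool) bs cs →
                     weight (filterᵇ S (bs ++ cs)) ≡ weight (filterᵇ S bs) + weight (filterᵇ S cs)
  weight-filter-++ S bs cs = trans (cong weight (filter-++ (T? ∘ S) bs cs)) (weight-++ (filterᵇ S bs) _)
    where
    weight-++ : ∀ bs cs → weight (bs ++ cs) ≡ weight bs + weight cs
    weight-++ []       cs = sym (+-identityˡ _)
    weight-++ (b ∷ bs) cs = trans (cong (wt b +_) (weight-++ bs cs)) (sym (+-assoc (wt b) _ _))

  weight-filter-map-filter : ∀ {C : Set} {j} (S : B → Bool) (F : C → B) (q : C → Bool) (f : Fin j → C) {w} →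
    (∀ c → wt (F c) ≡ w) →
    weight (filterᵇ S (map F (filterᵇ q (tabulate f)))) ≡ ℕtoℚ (∑[ ℓ < j ] ⟦ q (f ℓ) ∧ S (F (f ℓ)) ⟧) * w
  weight-filter-map-filter {j = zero}  S F q f {w} _ = sym (*-zeroˡ w)
  weight-filter-map-filter {j = suc j} S F q f {w} wt∘F≡w with q (f zero)
  ... | false = weight-filter-map-filter S F q (f ∘ suc) wt∘F≡w
  ... | true with S (F (f zero))
  ...   | false = weight-filter-map-filter S F q (f ∘ suc) wt∘F≡w
  ...   | true  = begin
    wt (F (f zero)) + weight (filterᵇ S (map F (filterᵇ q (tabulate (f ∘ suc)))))
      ≡⟨ cong₂ _+_ (wt∘F≡w (f zero)) (weight-filter-map-filter S F q (f ∘ suc) wt∘F≡w) ⟩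
    w + ℕtoℚ rest * w
      ≡⟨ cong (_+ ℕtoℚ rest * w) (*-identityˡ w) ⟨
    1ℚ * w + ℕtoℚ rest * w
      ≡⟨ ℕtoℚ-+-* 1 rest w ⟨
    ℕtoℚ (suc rest) * w ∎
    where
    open ≡-Reasoning
    rest = ∑[ ℓ < j ] ⟦ q (f (suc ℓ)) ∧ S (F (f (suc ℓ))) ⟧

  weight-filter-concatMap : ∀ {C : Set} {j} (S : B → Bool) (G : C → List B) (f : Fin j → C) (h : C → ℕ) {w} →
    (∀ c → weight (filterᵇ S (G c)) ≡ ℕtoℚ (h c) * w) →
    weight (filterᵇ S (concatMap G (tabulate f))) ≡ ℕtoℚ (∑[ i < j ] h (f i)) * w
  weight-filter-concatMap {j = zero}  S G f h {w} _ = sym (*-zeroˡ w)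
  weight-filter-concatMap {j = suc j} S G f h {w} weight-G = begin
    weight (filterᵇ S (G (f zero) ++ concatMap G (tabulate (f ∘ suc))))
      ≡⟨ weight-filter-++ S (G (f zero)) _ ⟩
    weight (filterᵇ S (G (f zero))) + weight (filterᵇ S (concatMap G (tabulate (f ∘ suc))))
      ≡⟨ cong₂ _+_ (weight-G (f zero)) (weight-filter-concatMap S G (f ∘ suc) h weight-G) ⟩
    ℕtoℚ (h (f zero)) * w + ℕtoℚ (∑[ i < j ] h (f (suc i))) * w
      ≡⟨ ℕtoℚ-+-* (h (f zero)) _ w ⟨
    ℕtoℚ (∑[ i < suc j ] h (f i)) * w ∎
    where
    open ≡-Reasoning

module Instance {n k : ℕ} (I : ExactCoverInstance n k) where
  open ExactCoverInstance I
  open Construction I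

  inF-Y-self : ∀ {i ℓ} → lookup (A i) ℓ ≡ true → inF i (Y i ℓ) ≡ false
  inF-Y-self {i} ℓ∈Aᵢ rewrite dec-true (i ≟F i) refl | ℓ∈Aᵢ = refl

  inF-Y≡false⇒≡ : ∀ {r i ℓ} → inF r (Y i ℓ) ≡ false → r ≡ i
  inF-Y≡false⇒≡ {r} {i} Y∉Fᵣ with r ≟F i
  ... | yes r≡i = r≡i
  ... | no _    = contradiction Y∉Fᵣ λ ()

  Ω-Y Ω-Z : List World
  Ω-Y = concatMap (λ i → map (Y i) (filterᵇ (lookup (A i)) (List.allFin n))) (List.allFin k)
  Ω-Z = map Z (List.allFin n)

  #Y #Z : WSet → ℕ
  #Y S = ∑[ i < k ] ∑[ ℓ < n ] ⟦ lookup (A i) ℓ ∧ S (Y i ℓ) ⟧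
  #Z S = ∑[ ℓ < n ] ⟦ S (Z ℓ) ⟧

  weight-Ω-Y++Ω-Z : ∀ S → weight π (filterᵇ S (Ω-Y ++ Ω-Z)) ≡ ℕtoℚ (#Y S) * y + ℕtoℚ (#Z S) * z
  weight-Ω-Y++Ω-Z S = trans (weight-filter-++ π S Ω-Y Ω-Z) (cong₂ _+_ weight-Ω-Y weight-Ω-Z)
    where
    weight-Ω-Y : weight π (filterᵇ S Ω-Y) ≡ ℕtoℚ (#Y S) * y
    weight-Ω-Y = weight-filter-concatMap π S _ id _ λ i →
                   weight-filter-map-filter π S (Y i) (lookup (A i)) id λ _ → refl
    weight-Ω-Z : weight π (filterᵇ S Ω-Z) ≡ ℕtoℚ (#Z S) * z
    weight-Ω-Z = trans (cong (weight π ∘ filterᵇ S ∘ map Z) (sym (filter-all _ (universal _ (List.allFin n)))))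
                       (weight-filter-map-filter π S Z (λ _ → true) id λ _ → refl)

  ℕtoℚ*z≡ : ∀ c → ℕtoℚ c * z ≡ ℕtoℚ (c ℕ.* (2 ℕ.* m)) * y
  ℕtoℚ*z≡ c = begin
    ℕtoℚ c * (ℕtoℚ 2 * ℕtoℚ m * y)    ≡⟨ *-assoc (ℕtoℚ c) _ y ⟨
    ℕtoℚ c * (ℕtoℚ 2 * ℕtoℚ m) * y    ≡⟨ cong (λ t → ℕtoℚ c * t * y) (ℕtoℚ-* 2 m) ⟨
    ℕtoℚ c * ℕtoℚ (2 ℕ.* m) * y       ≡⟨ cong (_* y) (ℕtoℚ-* c (2 ℕ.* m)) ⟨
    ℕtoℚ (c ℕ.* (2 ℕ.* m)) * y        ∎
    where
    open ≡-Reasoning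

  m≡∑∑ : m ≡ ∑[ i < k ] ∑[ ℓ < n ] ⟦ lookup (A i) ℓ ⟧
  m≡∑∑ = trans (foldr-tabulate≡sum (λ i → ∣ A i ∣) id) (sum-cong-≗ λ i → ∣p∣≡sum (A i))

  n≤m : n ℕ.≤ m
  n≤m = begin
    n                                         ≤⟨ size≤sum _ covered-by-some ⟩
    ∑[ ℓ < n ] ∑[ i < k ] ⟦ lookup (A i) ℓ ⟧  ≡⟨ ∑-comm (λ i ℓ → ⟦ lookup (A i) ℓ ⟧) ⟨
    ∑[ i < k ] ∑[ ℓ < n ] ⟦ lookup (A i) ℓ ⟧  ≡⟨ m≡∑∑ ⟨
    m                                         ∎
    where
    open ℕ.≤-Reasoning
    covered-by-some : ∀ ℓ → 1 ℕ.≤ ∑[ i < k ] ⟦ lookup (A i) ℓ ⟧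
    covered-by-some ℓ = let i , ℓ∈Aᵢ = covers ℓ in
      true-term⇒1≤sum (λ i → lookup (A i) ℓ) i ([]=⇒lookup ℓ∈Aᵢ)

  0<m : .{{ℕ.NonZero n}} → 0 ℕ.< m
  0<m = ℕ.≤-trans (ℕ.>-nonZero⁻¹ n) n≤m

module Observation {n k : ℕ} (I : ExactCoverInstance n k) (R : Subset k) where
  open ExactCoverInstance I
  open Construction I
  open Instance I

  ⋂-intro : ∀ w → (∀ i → lookup R i ≡ true → inF i w ≡ true) → ⋂ R w ≡ true
  ⋂-intro w w∈F = foldr-∧-true _ (List.allFin k) chosen⇒inF
    where
    chosen⇒inF : ∀ i → (if lookup R i then inF i w else true) ≡ true
    chosen⇒inF i with lookup R i in i∈R
    ... | true  = w∈F i i∈R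
    ... | false = refl

  ⋂-Y : ∀ i ℓ → lookup (A i) ℓ ≡ true → ⋂ R (Y i ℓ) ≡ not (lookup R i)
  ⋂-Y i ℓ ℓ∈Aᵢ with lookup R i in i∈R
  ... | true  = foldr-∧-false _ (∈-allFin i) (trans (cong (if_then _ else true) i∈R) (inF-Y-self ℓ∈Aᵢ))
  ... | false = ⋂-intro (Y i ℓ) other⇒inF
    where
    other⇒inF : ∀ j → lookup R j ≡ true → inF j (Y i ℓ) ≡ true
    other⇒inF j j∈R with inF j (Y i ℓ) in Y∈Fⱼ
    ... | true  = refl
    ... | false with refl ← inF-Y≡false⇒≡ Y∈Fⱼ = contradiction (trans (sym j∈R) i∈R) λ ()

  ⋂-Z⁻ : ∀ ℓ → ⋂ R (Z ℓ) ≡ false → ∃ λ j → lookup R j ≡ true × lookup (A j) ℓ ≡ true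
  ⋂-Z⁻ ℓ Z∉⋂ with foldr-∧-false⁻ _ (List.allFin k) Z∉⋂
  ... | j , Z∉Fⱼ with lookup R j in j∈R | lookup (A j) ℓ in ℓ∈Aⱼ
  ...   | true  | true  = j , j∈R , ℓ∈Aⱼ
  ...   | true  | false = contradiction Z∉Fⱼ λ ()
  ...   | false | _     = contradiction Z∉Fⱼ λ ()

  π*-⋂ : π* (⋂ R) ≡ x + x + ℕtoℚ (#Y (⋂ R)) * y + ℕtoℚ (#Z (⋂ R)) * z
  π*-⋂ = begin
    π* (⋂ R)
      ≡⟨ weight-filter-accept π (⋂ R) W0 _ (⋂-intro W0 λ _ _ → refl) ⟩
    x + weight π (filterᵇ (⋂ R) (X0 ∷ Ω-Y ++ Ω-Z))
      ≡⟨ cong (x +_) (weight-filter-accept π (⋂ R) X0 _ (⋂-intro X0 λ _ _ → refl)) ⟩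
    x + (x + weight π (filterᵇ (⋂ R) (Ω-Y ++ Ω-Z)))
      ≡⟨ cong (λ t → x + (x + t)) (weight-Ω-Y++Ω-Z (⋂ R)) ⟩
    x + (x + (ℕtoℚ (#Y (⋂ R)) * y + ℕtoℚ (#Z (⋂ R)) * z))
      ≡⟨ +-assoc x x (ℕtoℚ (#Y (⋂ R)) * y + ℕtoℚ (#Z (⋂ R)) * z) ⟨
    x + x + (ℕtoℚ (#Y (⋂ R)) * y + ℕtoℚ (#Z (⋂ R)) * z)
      ≡⟨ +-assoc (x + x) (ℕtoℚ (#Y (⋂ R)) * y) (ℕtoℚ (#Z (⋂ R)) * z) ⟨
    x + x + ℕtoℚ (#Y (⋂ R)) * y + ℕtoℚ (#Z (⋂ R)) * z ∎
    where
    open ≡-Reasoning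

  π*-E∩⋂ : π* (inE ∩ ⋂ R) ≡ x + ℕtoℚ (#Y (⋂ R)) * y
  π*-E∩⋂ = begin
    π* (inE ∩ ⋂ R)
      ≡⟨ weight-filter-accept π (inE ∩ ⋂ R) W0 _ (⋂-intro W0 λ _ _ → refl) ⟩
    x + weight π (filterᵇ (inE ∩ ⋂ R) (Ω-Y ++ Ω-Z))
      ≡⟨ cong (x +_) (weight-Ω-Y++Ω-Z (inE ∩ ⋂ R)) ⟩
    x + (ℕtoℚ (#Y (⋂ R)) * y + ℕtoℚ (#Z (inE ∩ ⋂ R)) * z)
      ≡⟨ cong (λ c → x + (ℕtoℚ (#Y (⋂ R)) * y + ℕtoℚ c * z)) (sum-replicate-zero n) ⟩
    x + (ℕtoℚ (#Y (⋂ R)) * y + 0ℚ * z)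
      ≡⟨ cong (λ t → x + (ℕtoℚ (#Y (⋂ R)) * y + t)) (*-zeroˡ z) ⟩
    x + (ℕtoℚ (#Y (⋂ R)) * y + 0ℚ)
      ≡⟨ cong (x +_) (+-identityʳ (ℕtoℚ (#Y (⋂ R)) * y)) ⟩
    x + ℕtoℚ (#Y (⋂ R)) * y ∎
    where
    open ≡-Reasoning

  multiplicity : Fin n → ℕ
  multiplicity ℓ = ∑[ i < k ] ⟦ lookup (A i) ℓ ∧ lookup R i ⟧

  chosen⇒1≤multiplicity : ∀ {j ℓ} → lookup R j ≡ true → lookup (A j) ℓ ≡ true → 1 ℕ.≤ multiplicity ℓ
  chosen⇒1≤multiplicity {j} {ℓ} j∈R ℓ∈Aⱼ =
    true-term⇒1≤sum (λ i → lookup (A i) ℓ ∧ lookup R i) j (cong₂ _∧_ ℓ∈Aⱼ j∈R)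

  #Y⋂+∑multiplicity≡m : #Y (⋂ R) ℕ.+ ∑[ ℓ < n ] multiplicity ℓ ≡ m
  #Y⋂+∑multiplicity≡m = begin
    #Y (⋂ R) ℕ.+ ∑[ ℓ < n ] multiplicity ℓ
      ≡⟨ cong₂ ℕ._+_ (sum-cong-≗ λ i → sum-cong-≗ (Y-term i)) (∑-comm (λ ℓ i → removed i ℓ)) ⟩
    ∑[ i < k ] ∑[ ℓ < n ] kept i ℓ ℕ.+ ∑[ i < k ] ∑[ ℓ < n ] removed i ℓ
      ≡⟨ ∑-distrib-+ (λ i → ∑[ ℓ < n ] kept i ℓ) _ ⟨
    ∑[ i < k ] (∑[ ℓ < n ] kept i ℓ ℕ.+ ∑[ ℓ < n ] removed i ℓ)
      ≡⟨ sum-cong-≗ (λ i → ∑-distrib-+ (kept i) (removed i)) ⟨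
    ∑[ i < k ] ∑[ ℓ < n ] (kept i ℓ ℕ.+ removed i ℓ)
      ≡⟨ sum-cong-≗ (λ i → sum-cong-≗ λ ℓ → ⟦∧not⟧+⟦∧⟧≡⟦⟧ (lookup (A i) ℓ) (lookup R i)) ⟩
    ∑[ i < k ] ∑[ ℓ < n ] ⟦ lookup (A i) ℓ ⟧
      ≡⟨ m≡∑∑ ⟨
    m ∎
    where
    open ≡-Reasoning
    kept removed : Fin k → Fin n → ℕ
    kept    i ℓ = ⟦ lookup (A i) ℓ ∧ not (lookup R i) ⟧
    removed i ℓ = ⟦ lookup (A i) ℓ ∧ lookup R i ⟧
    Y-term : ∀ i ℓ → ⟦ lookup (A i) ℓ ∧ ⋂ R (Y i ℓ) ⟧ ≡ kept i ℓ
    Y-term i ℓ with lookup (A i) ℓ in ℓ∈Aᵢ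
    ... | true  = cong ⟦_⟧ (⋂-Y i ℓ ℓ∈Aᵢ)
    ... | false = refl

  CountBound : Set
  CountBound = (m ∸ n) ℕ.+ #Z (⋂ R) ℕ.* (2 ℕ.* m) ℕ.≤ #Y (⋂ R)

  τ≤condP⇒bound : .{{ℕ.NonZero n}} → τ ≤ condP R → CountBound
  τ≤condP⇒bound τ≤P =
    ℕtoℚ-cancel-≤ (subst (_≤ ℕtoℚ (#Y (⋂ R))) (sym (ℕtoℚ-+ (m ∸ n) (#Z (⋂ R) ℕ.* (2 ℕ.* m))))
      (ratio-≤⇒a+c≤b x y (ℕtoℚ (m ∸ n)) (ℕtoℚ (#Y (⋂ R))) (ℕtoℚ (#Z (⋂ R) ℕ.* (2 ℕ.* m)))
        (subst₂ _≤_ τ≡ condP≡ τ≤P)))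
    where
    instance
      _ = ℕ.>-nonZero 0<m
      _ = ℕtoℚ-pos m
      _ = ℕtoℚ-nonNeg (m ∸ n)
      _ = ℕtoℚ-nonNeg (#Y (⋂ R))
      _ = ℕtoℚ-nonNeg (#Z (⋂ R) ℕ.* (2 ℕ.* m))
      _ = nonNeg*nonNeg⇒nonNeg (ℕtoℚ 2) {{ℕtoℚ-nonNeg 2}} (ℕtoℚ n) {{ℕtoℚ-nonNeg n}}
      _ = pos+nonNeg⇒pos 1ℚ (ℕtoℚ 2 * ℕtoℚ n)
      _ = pos*pos⇒pos (ℕtoℚ m) (1ℚ + ℕtoℚ 2 * ℕtoℚ n)
      y>0 : Positive y
      y>0 = pos÷ₜpos⇒pos (1ℚ - ℕtoℚ 2 * x) (ℕtoℚ m * (1ℚ + ℕtoℚ 2 * ℕtoℚ n))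
    doubling-x : ℕtoℚ 2 * x ≡ x + x
    doubling-x = refl
    τ≡ : τ ≡ (x + ℕtoℚ (m ∸ n) * y) ÷ₜ (x + x + ℕtoℚ (m ∸ n) * y)
    τ≡ = cong₂ (λ d t → (x + d * y) ÷ₜ (t + d * y)) (ℕtoℚ-∸ n≤m) doubling-x
    condP≡ : condP R ≡ (x + ℕtoℚ (#Y (⋂ R)) * y) ÷ₜ
                       (x + x + ℕtoℚ (#Y (⋂ R)) * y + ℕtoℚ (#Z (⋂ R) ℕ.* (2 ℕ.* m)) * y)
    condP≡ = cong₂ _÷ₜ_ π*-E∩⋂ (trans π*-⋂ (cong (x + x + ℕtoℚ (#Y (⋂ R)) * y +_) (ℕtoℚ*z≡ (#Z (⋂ R)))))

  bound⇒#Z⋂≡0 : .{{ℕ.NonZero n}} → CountBound → #Z (⋂ R) ≡ 0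
  bound⇒#Z⋂≡0 bound = m<n⇒c*n≤m⇒c≡0 (ℕ.m<m+n m (ℕ.≤-trans 0<m (ℕ.m≤m+n m 0)))
                        (ℕ.≤-trans (ℕ.m≤n+m _ (m ∸ n)) (ℕ.≤-trans bound #Y⋂≤m))
    where
    #Y⋂≤m : #Y (⋂ R) ℕ.≤ m
    #Y⋂≤m = ℕ.≤-trans (ℕ.m≤m+n _ _) (ℕ.≤-reflexive #Y⋂+∑multiplicity≡m)

  bound⇒∑multiplicity≤n : CountBound → ∑[ ℓ < n ] multiplicity ℓ ℕ.≤ n
  bound⇒∑multiplicity≤n bound = ℕ.+-cancelˡ-≤ (#Y (⋂ R)) _ n (begin
    #Y (⋂ R) ℕ.+ ∑[ ℓ < n ] multiplicity ℓ  ≡⟨ #Y⋂+∑multiplicity≡m ⟩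
    m                                       ≡⟨ ℕ.m+[n∸m]≡n n≤m ⟨
    n ℕ.+ (m ∸ n)                           ≤⟨ ℕ.+-monoʳ-≤ n (ℕ.≤-trans (ℕ.m≤m+n (m ∸ n) _) bound) ⟩
    n ℕ.+ #Y (⋂ R)                          ≡⟨ ℕ.+-comm n _ ⟩
    #Y (⋂ R) ℕ.+ n                          ∎)
    where
    open ℕ.≤-Reasoning

  #Z⋂≡0⇒chosen-cover : #Z (⋂ R) ≡ 0 → ∀ ℓ → ∃ λ j → lookup R j ≡ true × lookup (A j) ℓ ≡ true
  #Z⋂≡0⇒chosen-cover #Z≡0 ℓ = ⋂-Z⁻ ℓ (⟦⟧≡0⇒≡false (sum≡0⇒term≡0 _ #Z≡0 ℓ))

  InH⇒chosen : ∀ {i} → InH R i → lookup R i ≡ true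
  InH⇒chosen (r , r∈R , ℓ , _ , Y∉Fᵣ) with refl ← inF-Y≡false⇒≡ Y∉Fᵣ = []=⇒lookup r∈R

  chosen⇒InH : ∀ {j ℓ} → lookup R j ≡ true → lookup (A j) ℓ ≡ true → InH R j
  chosen⇒InH {j} {ℓ} j∈R ℓ∈Aⱼ = j , lookup⇒[]= j R j∈R , ℓ , lookup⇒[]= ℓ (A j) ℓ∈Aⱼ , inF-Y-self ℓ∈Aⱼ

  multiplicity≤1⇒disjoint : ∀ {ℓ i j} → multiplicity ℓ ℕ.≤ 1 → InH R i → InH R j → i ≢ j →
                            ¬ (ℓ ∈ₛ A i × ℓ ∈ₛ A j)
  multiplicity≤1⇒disjoint {ℓ} {i} {j} mult≤1 i∈H j∈H i≢j (ℓ∈Aᵢ , ℓ∈Aⱼ) =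
    contradiction (ℕ.≤-trans (ℕ.≤-reflexive (sym (cong₂ ℕ._+_ (term≡1 ℓ∈Aᵢ i∈H) (term≡1 ℓ∈Aⱼ j∈H))))
                             (ℕ.≤-trans (two-terms≤sum _ i≢j) mult≤1))
                  (ℕ.<⇒≱ (s≤s (s≤s z≤n)))
    where
    term≡1 : ∀ {r} → ℓ ∈ₛ A r → InH R r → ⟦ lookup (A r) ℓ ∧ lookup R r ⟧ ≡ 1
    term≡1 ℓ∈Aᵣ r∈H = cong ⟦_⟧ (cong₂ _∧_ ([]=⇒lookup ℓ∈Aᵣ) (InH⇒chosen r∈H))

mainTheorem6 : ∀ {n k : ℕ} (I : ExactCoverInstance n k) (R : Subset k) →
                 Construction.τ I ≤ Construction.condP I R →
                 Construction.IsExactCover I R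
mainTheorem6 {zero}  I R _    = (λ _ _ _ _ _ ()) , (λ ())
mainTheorem6 {suc _} I R τ≤P = disjoint , covering
  where
  open ExactCoverInstance I
  open Construction I using (InH)
  open Observation I R
  bound : CountBound
  bound = τ≤condP⇒bound τ≤P
  chosen-cover : ∀ ℓ → ∃ λ j → lookup R j ≡ true × lookup (A j) ℓ ≡ true
  chosen-cover = #Z⋂≡0⇒chosen-cover (bound⇒#Z⋂≡0 bound)
  multiplicity≤1 : ∀ ℓ → multiplicity ℓ ℕ.≤ 1
  multiplicity≤1 = sum≤size⇒term≤1 multiplicity
    (λ ℓ → let j , j∈R , ℓ∈Aⱼ = chosen-cover ℓ in chosen⇒1≤multiplicity j∈R ℓ∈Aⱼ)
    (bound⇒∑multiplicity≤n bound)
  disjoint : ∀ i j → InH R i → InH R j → A i ≢ A j → ∀ ℓ → ¬ (ℓ ∈ₛ A i × ℓ ∈ₛ A j)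
  disjoint i j i∈H j∈H Aᵢ≢Aⱼ ℓ = multiplicity≤1⇒disjoint (multiplicity≤1 ℓ) i∈H j∈H (Aᵢ≢Aⱼ ∘ cong A)
  covering : ∀ ℓ → ∃ λ i → InH R i × ℓ ∈ₛ A i
  covering ℓ = let j , j∈R , ℓ∈Aⱼ = chosen-cover ℓ in j , chosen⇒InH j∈R ℓ∈Aⱼ , lookup⇒[]= ℓ (A j) ℓ∈Aⱼ
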